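{- Let $(G,F)$ be a framed DAG. Then any maximal clique $K$ of $(G,F)$ uses every edge of $G$, i.e. every edge of $G$ lies on some route of $K$.
   Context: $G=(V,E)$ is a finite connected directed acyclic graph; sources have indegree 0, sinks outdegree 0, other vertices are internal; by convention sources and sinks have degree one and there are no idle edges (edges between internal vertices that are the only outgoing edge of their tail or the only incoming edge of their head). A framing $F$ chooses at each internal vertex $v$ total orders on $\mathrm{in}(v)$ and $\mathrm{out}(v)$. For distinct walks $\rho,\rho'$ from a source to internal $v$, let $e,e'$ be the last edges at which they differ (with common head $u$) and set $\rho\prec\rho'$ iff $e\prec e'$ in $\mathrm{in}(u)$; dually for walks from $v$ to a sink, using the first differing edges and the order on $\mathrm{out}(u)$. Routes are directed walks from a source to a sink; $\rho,\rho'$ sharing an internal vertex $v$ are incompatible at $v$ if $\mathrm{prefix}(\rho,v)\prec\mathrm{prefix}(\rho',v)$ and $\mathrm{suffix}(\rho',v)\prec\mathrm{suffix}(\rho,v)$ or vice versa (prefix/suffix: parts of the route before/after $v$); they are compatible if compatible at every common internal vertex. A clique is a set of pairwise compatible routes; maximal means inclusion-maximal. -}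

module Defs where

open import Data.Nat using (ℕ; _≤_)
open import Data.Fin using (Fin)
open import Data.Fin.Properties using (_≟_)
open import Data.List using (List; []; _∷_; [_]; _++_; reverse; length; filter)
open import Data.List.Base using (allFin)
open import Data.List.Membership.Propositional using (_∈_)
open import Data.Product using (Σ; ∃; ∃-syntax; _×_; _,_)
open import Data.Sum using (_⊎_)
open import Data.Empty using (⊥)
open import Relation.Nullary using (¬_)
open import Relation.Binary.PropositionalEquality using (_≡_; _≢_)

record Graph : Set where
  field
    n m  : ℕ
    tail : Fin m → Fin n
    head : Fin m → Fin n

  Vertex : Set
  Vertex = Fin n

  Edge : Set
  Edge = Fin m

  indeg : Vertex → ℕ
  indeg v = length (filter (λ e → head e ≟ v) (allFin m))

  outdeg : Vertex → ℕ
  outdeg v = length (filter (λ e → tail e ≟ v) (allFin m))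

  IsSource : Vertex → Set
  IsSource v = indeg v ≡ 0

  IsSink : Vertex → Set
  IsSink v = outdeg v ≡ 0

  IsInternal : Vertex → Set
  IsInternal v = (1 ≤ indeg v) × (1 ≤ outdeg v)

  data Path : Vertex → Vertex → List Edge → Set where
    one  : (e : Edge) → Path (tail e) (head e) [ e ]
    cons : (e : Edge) {w : Vertex} {es : List Edge} →
           Path (head e) w es → Path (tail e) w (e ∷ es)

  data UPath : Vertex → Vertex → Set where
    here : {v : Vertex} → UPath v v
    fwd  : (e : Edge) {w : Vertex} → UPath (head e) w → UPath (tail e) w
    bwd  : (e : Edge) {w : Vertex} → UPath (tail e) w → UPath (head e) w

  Connected : Set
  Connected = (u v : Vertex) → UPath u v

  Acyclic : Set
  Acyclic = (v : Vertex) (es : List Edge) → ¬ Path v v es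

  DegreeConvention : Set
  DegreeConvention =
    ((v : Vertex) → IsSource v → outdeg v ≡ 1) ×
    ((v : Vertex) → IsSink v → indeg v ≡ 1)

  IsIdle : Edge → Set
  IsIdle e = IsInternal (tail e) × IsInternal (head e) ×
             (outdeg (tail e) ≡ 1 ⊎ indeg (head e) ≡ 1)

  NoIdleEdges : Set
  NoIdleEdges = (e : Edge) → ¬ IsIdle e

  IsRoute : List Edge → Set
  IsRoute es = Σ Vertex λ s → Σ Vertex λ t → IsSource s × IsSink t × Path s t es

record IsStrictTotalOn {A : Set} (P : A → Set) (R : A → A → Set) : Set where
  field
    irrefl : ∀ {x} → P x → ¬ R x x
    trans  : ∀ {x y z} → P x → P y → P z → R x y → R y z → R x z
    trich  : ∀ {x y} → P x → P y → R x y ⊎ x ≡ y ⊎ R y x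

record FramedDAG : Set₁ where
  field
    graph : Graph
  open Graph graph public
  field
    connected   : Connected
    acyclic     : Acyclic
    degreeConv  : DegreeConvention
    noIdle      : NoIdleEdges
    inLt        : Vertex → Edge → Edge → Set
    outLt       : Vertex → Edge → Edge → Set
    inTotal     : (v : Vertex) → IsInternal v →
                  IsStrictTotalOn (λ e → head e ≡ v) (inLt v)
    outTotal    : (v : Vertex) → IsInternal v →
                  IsStrictTotalOn (λ e → tail e ≡ v) (outLt v)

  -- Order on walks ending at a common vertex, given as REVERSED edge
  -- lists: compare the last edges at which they differ (common head u),
  -- using the order on in(u).
  RevPrefixLt : List Edge → List Edge → Set
  RevPrefixLt [] _ = ⊥
  RevPrefixLt (_ ∷ _) [] = ⊥
  RevPrefixLt (e ∷ r) (e' ∷ r') =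
    (e ≡ e' × RevPrefixLt r r') ⊎ (e ≢ e' × inLt (head e) e e')

  SuffixLt : List Edge → List Edge → Set
  SuffixLt [] _ = ⊥
  SuffixLt (_ ∷ _) [] = ⊥
  SuffixLt (e ∷ r) (e' ∷ r') =
    (e ≡ e' × SuffixLt r r') ⊎ (e ≢ e' × outLt (tail e) e e')

  PrefixLt : List Edge → List Edge → Set
  PrefixLt p p' = RevPrefixLt (reverse p) (reverse p')

  -- ρ and ρ' are incompatible at v: v is an internal vertex of both,
  -- ρ = p ++ s and ρ' = p' ++ s' with p, p' (non-empty) ending at v and
  -- s, s' (non-empty) starting at v, and the prefix/suffix orders cross.
  IncompatibleAt : Vertex → List Edge → List Edge → Set
  IncompatibleAt v ρ ρ' =
    Σ (List Edge) λ q → Σ Edge λ e → Σ Edge λ f → Σ (List Edge) λ t →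
    Σ (List Edge) λ q' → Σ Edge λ e' → Σ Edge λ f' → Σ (List Edge) λ t' →
      ρ ≡ q ++ e ∷ f ∷ t × head e ≡ v ×
      ρ' ≡ q' ++ e' ∷ f' ∷ t' × head e' ≡ v ×
      let p = q ++ [ e ] ; s = f ∷ t ; p' = q' ++ [ e' ] ; s' = f' ∷ t' in
      ((PrefixLt p p' × SuffixLt s' s) ⊎ (PrefixLt p' p × SuffixLt s s'))

  Compatible : List Edge → List Edge → Set
  Compatible ρ ρ' = (v : Vertex) → ¬ IncompatibleAt v ρ ρ'

  IsClique : List (List Edge) → Set
  IsClique K = ((ρ : List Edge) → ρ ∈ K → IsRoute ρ) ×
               ((ρ ρ' : List Edge) → ρ ∈ K → ρ' ∈ K → Compatible ρ ρ')

  _⊆_ : List (List Edge) → List (List Edge) → Set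
  K ⊆ K' = (ρ : List Edge) → ρ ∈ K → ρ ∈ K'

  IsMaximalClique : List (List Edge) → Set
  IsMaximalClique K = IsClique K ×
    ((K' : List (List Edge)) → IsClique K' → K ⊆ K' → K' ⊆ K)

-- If no route of K uses the edge e, we build a route ρ through e that is compatible with
-- every route of K; maximality then puts ρ into K.  From the head of e we walk forward,
-- taking any outgoing edge as long as no route of K passes through the current vertex.  At
-- the first vertex w that some route of K passes through, we switch to the suffix of a
-- route σ ∈ K through w: among those entering w below our incoming edge the one with the
-- largest suffix, or, if there is none, the one with the smallest suffix.  A comparison of
-- ρ with a route τ ∈ K at a vertex after e is then decided either at w, where the choice of
-- σ rules out a crossing, or on the part that ρ shares with σ, where a crossing of ρ and τ
-- would be one of σ and τ.  The part of ρ before e is built in the same way, backwards.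
module Submission where

open import Defs
open import Data.Empty using (⊥; ⊥-elim)
open import Data.Unit using (⊤; tt)
open import Data.Fin using (Fin; zero; suc)
open import Data.Fin.Properties using (_≟_; any?; injective⇒≤)
open import Data.List
  using (List; []; _∷_; [_]; _++_; _ʳ++_; reverse; length; lookup; filter; map; concatMap; allFin)
open import Data.List.Properties
  using ( ∷-injective; ++-identityʳ; ++-conicalʳ; ʳ++-defn; reverse-involutive; reverse-++
        ; reverse-injective; unfold-reverse; filter-none)
open import Data.List.Membership.Propositional using (_∈_; _∉_; find; lose)
open import Data.List.Membership.Propositional.Properties
  using ( ∈-++⁺ʳ; ∈-map⁺; ∈-map⁻; ∈-concatMap⁺; ∈-concatMap⁻; ∈-filter⁺; ∈-filter⁻
        ; ∈-lookup; ∈-length; ∈-allFin)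
open import Data.List.Relation.Unary.All as All using (All; []; _∷_)
open import Data.List.Relation.Unary.AllPairs using ([]; _∷_)
import Data.List.Relation.Unary.Any as Any
open import Data.List.Relation.Unary.Any using (here; there)
import Data.List.Membership.DecPropositional as DecMembership
open import Data.List.Relation.Unary.Unique.Propositional using (Unique)
open import Data.Nat using (zero; suc; _≤_; _+_)
open import Data.Nat.Properties as ℕ using ()
import Data.Product as Product
open import Data.Product using (Σ; ∃; ∃₂; _×_; _,_; proj₁; proj₂; uncurry)
open import Data.Sum using (_⊎_; inj₁; inj₂) renaming (swap to ⊎-swap)
open import Function using (Injective; _∘_; id; flip; case_of_)
open import Induction.WellFounded using (Acc; acc; WellFounded)
open import Relation.Nullary using (¬_; Dec; yes; no)
open import Relation.Binary.PropositionalEquality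
  using (_≡_; _≢_; refl; sym; trans; cong; subst; subst₂; module ≡-Reasoning)

private variable
  A : Set

++-split : ∀ (xs ys : List A) {zs ws} → xs ++ zs ≡ ys ++ ws →
           (∃ λ c → xs ≡ ys ++ c × ws ≡ c ++ zs) ⊎ (∃ λ c → ys ≡ xs ++ c × zs ≡ c ++ ws)
++-split []       ys       eq = inj₂ (ys , refl , eq)
++-split (x ∷ xs) []       eq = inj₁ (x ∷ xs , refl , sym eq)
++-split (x ∷ xs) (y ∷ ys) eq with ∷-injective eq
... | refl , eq′ with ++-split xs ys eq′
...   | inj₁ (c , xs≡ , ws≡) = inj₁ (c , cong (x ∷_) xs≡ , ws≡)
...   | inj₂ (c , ys≡ , zs≡) = inj₂ (c , cong (x ∷_) ys≡ , zs≡)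

reverse-ʳ++ : ∀ (xs : List A) {ys} → reverse xs ʳ++ ys ≡ xs ++ ys
reverse-ʳ++ xs {ys} = trans (ʳ++-defn (reverse xs)) (cong (_++ ys) (reverse-involutive xs))

reverse-≡-++ : ∀ (xs ys : List A) {c} → reverse xs ≡ reverse ys ++ c → xs ≡ c ʳ++ ys
reverse-≡-++ xs ys {c} eq = begin
  xs                                ≡⟨ reverse-involutive xs ⟨
  reverse (reverse xs)              ≡⟨ cong reverse eq ⟩
  reverse (reverse ys ++ c)         ≡⟨ reverse-++ (reverse ys) c ⟩
  reverse c ++ reverse (reverse ys) ≡⟨ cong (reverse c ++_) (reverse-involutive ys) ⟩
  reverse c ++ ys                   ≡⟨ ʳ++-defn c ⟨
  c ʳ++ ys                          ∎
  where open ≡-Reasoning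

ʳ++-split : ∀ (xs ys : List A) {zs ws} → xs ʳ++ zs ≡ ys ʳ++ ws →
            (∃ λ c → xs ≡ c ʳ++ ys × ws ≡ c ++ zs) ⊎ (∃ λ c → ys ≡ c ʳ++ xs × zs ≡ c ++ ws)
ʳ++-split xs ys eq
  with ++-split (reverse xs) (reverse ys) (trans (sym (ʳ++-defn xs)) (trans eq (ʳ++-defn ys)))
... | inj₁ (c , xs≡ , ws≡) = inj₁ (c , reverse-≡-++ xs ys xs≡ , ws≡)
... | inj₂ (c , ys≡ , zs≡) = inj₂ (c , reverse-≡-++ ys xs ys≡ , zs≡)

IsCons : List A → Set
IsCons xs = ∃₂ λ y ys → xs ≡ y ∷ ys

∈-ʳ++-∷ : ∀ (xs : List A) {x ys} → x ∈ xs ʳ++ (x ∷ ys)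
∈-ʳ++-∷ xs = subst (_ ∈_) (sym (ʳ++-defn xs)) (∈-++⁺ʳ (reverse xs) (here refl))

splitsʳ : List A → List A → List (List A × List A)
splitsʳ xs []       = [ (xs , []) ]
splitsʳ xs (y ∷ ys) = (xs , y ∷ ys) ∷ splitsʳ (y ∷ xs) ys

splitsʳ-sound : ∀ (xs ys : List A) {xs′ ys′} → (xs′ , ys′) ∈ splitsʳ xs ys →
                xs′ ʳ++ ys′ ≡ xs ʳ++ ys
splitsʳ-sound xs []       (here refl) = refl
splitsʳ-sound xs (y ∷ ys) (here refl) = refl
splitsʳ-sound xs (y ∷ ys) (there m)   = splitsʳ-sound (y ∷ xs) ys m

splitsʳ-complete : ∀ (xs ys : List A) → (xs , ys) ∈ splitsʳ [] (xs ʳ++ ys)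
splitsʳ-complete xs ys =
  subst₂ (λ X Y → (X , ys) ∈ splitsʳ [] Y) (trans (reverse-ʳ++ xs) (++-identityʳ xs)) (sym (ʳ++-defn xs))
         (from-front (reverse xs) [] ys)
  where
    from-front : ∀ (cs xs ys : List A) → (cs ʳ++ xs , ys) ∈ splitsʳ xs (cs ++ ys)
    from-front []       xs []      = here refl
    from-front []       xs (_ ∷ _) = here refl
    from-front (c ∷ cs) xs ys      = there (from-front cs (c ∷ xs) ys)

lookup-injective : ∀ {k} (xs : List (Fin k)) → Unique xs → Injective _≡_ _≡_ (lookup xs)
lookup-injective (x ∷ xs) (x∉xs ∷ u) {zero}  {zero}  eq = refl
lookup-injective (x ∷ xs) (x∉xs ∷ u) {zero}  {suc j} eq = ⊥-elim (All.lookup x∉xs (∈-lookup j) eq)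
lookup-injective (x ∷ xs) (x∉xs ∷ u) {suc i} {zero}  eq = ⊥-elim (All.lookup x∉xs (∈-lookup i) (sym eq))
lookup-injective (x ∷ xs) (x∉xs ∷ u) {suc i} {suc j} eq = cong suc (lookup-injective xs u eq)

length-unique-≤ : ∀ {k} (xs : List (Fin k)) → Unique xs → length xs ≤ k
length-unique-≤ xs u = injective⇒≤ (lookup-injective xs u)

Enumeration : {B C : Set} → (B → C → Set) → Set
Enumeration {B} {C} R =
  Σ (List (B × C)) λ L → (∀ {b c} → (b , c) ∈ L → R b c) × (∀ {b c} → R b c → (b , c) ∈ L)

enumeration-flip : {B C : Set} {R : B → C → Set} → Enumeration R → Enumeration (flip R)
enumeration-flip (L , sound , complete) = map Product.swap L , sound′ , complete′
  where
    sound′ : ∀ {c b} → (c , b) ∈ map Product.swap L → _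
    sound′ cb∈ with ∈-map⁻ Product.swap cb∈
    ... | (_ , _) , bc∈ , refl = sound bc∈
    complete′ : ∀ {c b} → _ → (c , b) ∈ map Product.swap L
    complete′ r = ∈-map⁺ Product.swap (complete r)

module _ (Ok Q : A → Set) (_<_ : A → A → Set)
         (Q? : ∀ {x} → Ok x → Dec (Q x))
         (<-irrefl : ∀ {x} → ¬ x < x)
         (<-trans : ∀ {x y z} → Ok x → Ok y → Ok z → x < y → y < z → x < z)
         (<-dec : ∀ {x y} → Ok x → Ok y → Dec (x < y)) where

  maximal-satisfying : ∀ xs → All Ok xs →
    All (¬_ ∘ Q) xs ⊎ ∃ λ m → m ∈ xs × Q m × ∀ {y} → y ∈ xs → Q y → ¬ m < y
  maximal-satisfying [] [] = inj₁ []
  maximal-satisfying (x ∷ xs) (okx ∷ oks) with maximal-satisfying xs oks | Q? okx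
  ... | inj₁ none | no ¬qx = inj₁ (¬qx ∷ none)
  ... | inj₁ none | yes qx =
    inj₂ (x , here refl , qx , λ
      { (here refl) _ → <-irrefl
      ; (there y∈) qy → ⊥-elim (All.lookup none y∈ qy) })
  ... | inj₂ (m , m∈ , qm , m-max) | no ¬qx =
    inj₂ (m , there m∈ , qm , λ { (here refl) qy → ⊥-elim (¬qx qy) ; (there y∈) → m-max y∈ })
  ... | inj₂ (m , m∈ , qm , m-max) | yes qx with <-dec (All.lookup oks m∈) okx
  ...   | no m≮x = inj₂ (m , there m∈ , qm , λ { (here refl) _ → m≮x ; (there y∈) → m-max y∈ })
  ...   | yes m<x = inj₂ (x , here refl , qx , λ
          { (here refl) _ → <-irrefl
          ; (there y∈) qy x<y →
              m-max y∈ qy (<-trans (All.lookup oks m∈) okx (All.lookup oks y∈) m<x x<y) })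

module FramedDAGTheory (G : FramedDAG) where
  open FramedDAG G
  open IsStrictTotalOn renaming (irrefl to order-irrefl; trans to order-trans; trich to order-trich)

  -- Walks, degrees and acyclicity

  -- A walk in either orientation: each edge e is left at k e and entered at k' e,
  -- so Walk tail head follows the edges and Walk head tail runs against them.
  data Walk (k k' : Edge → Vertex) : Vertex → Vertex → List Edge → Set where
    done : ∀ {v} → Walk k k' v v []
    step : ∀ {u v} e {es} → k e ≡ u → Walk k k' (k' e) v es → Walk k k' u v (e ∷ es)

  data MaxWalk (k k' : Edge → Vertex) : Vertex → List Edge → Set where
    stuck : ∀ {v} → (∀ e → k e ≢ v) → MaxWalk k k' v []
    step  : ∀ {v} e {es} → k e ≡ v → MaxWalk k k' (k' e) es → MaxWalk k k' v (e ∷ es)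

  module _ {k k' : Edge → Vertex} where

    walk-∷ʳ : ∀ {u v es f} → Walk k k' u v es → k f ≡ v → Walk k k' u (k' f) (es ++ [ f ])
    walk-∷ʳ done           f↤v = step _ f↤v done
    walk-∷ʳ (step e e↤u w) f↤v = step e e↤u (walk-∷ʳ w f↤v)

    maxWalk-split : ∀ {v} xs {ys} → MaxWalk k k' v (xs ++ ys) →
                    ∃ λ u → Walk k k' v u xs × MaxWalk k k' u ys
    maxWalk-split []       w               = _ , done , w
    maxWalk-split (x ∷ xs) (step .x x↤v w) with maxWalk-split xs w
    ... | u , front , back = u , step x x↤v front , back

    Successor : Vertex → Vertex → Set
    Successor v u = ∃ λ f → k f ≡ u × k' f ≡ v

    module _ (acyclic : ∀ {v es} → Walk k k' v v es → es ≡ []) where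

      private
        closing-walk : ∀ {w hs f} → (∀ {y} → y ∈ hs → ∃ (Walk k k' y w)) → k f ≡ w →
                       ∀ {y} → y ∈ w ∷ hs → ∃ λ es → Walk k k' y (k' f) (es ++ [ f ])
        closing-walk reaches f↤w (here refl) = [] , step _ f↤w done
        closing-walk reaches f↤w (there y∈) with reaches y∈
        ... | es , y⇝w = es , walk-∷ʳ y⇝w f↤w

        fresh : ∀ {w hs f} → (∀ {y} → y ∈ hs → ∃ (Walk k k' y w)) → k f ≡ w →
                All (k' f ≢_) (w ∷ hs)
        fresh {f = f} reaches f↤w =
          All.tabulate λ y∈ f↦y → no-cycle (closing-walk reaches f↤w y∈) f↦y
          where
            no-cycle : ∀ {y} → (∃ λ es → Walk k k' y (k' f) (es ++ [ f ])) → k' f ≢ y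
            no-cycle (es , y⇝y) refl with ++-conicalʳ es [ f ] (acyclic y⇝y)
            ... | ()

        -- hs are distinct vertices from which w is reachable, so there are fewer than n of them.
        acc-avoiding : ∀ N {w} hs → Unique (w ∷ hs) → (∀ {y} → y ∈ hs → ∃ (Walk k k' y w)) →
                       n ≤ N + length hs → Acc Successor w
        acc-avoiding zero {w} hs unique _ bound =
          ⊥-elim (ℕ.<-irrefl refl (ℕ.≤-trans (length-unique-≤ (w ∷ hs) unique) bound))
        acc-avoiding (suc N) {w} hs unique reaches bound = acc λ where
          (f , f↤w , refl) →
            acc-avoiding N (w ∷ hs) (fresh reaches f↤w ∷ unique)
              (Product.map (_++ [ f ]) id ∘ closing-walk reaches f↤w)
              (subst (n ≤_) (sym (ℕ.+-suc N (length hs))) bound)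

      successor-wellFounded : WellFounded Successor
      successor-wellFounded w = acc-avoiding n [] ([] ∷ []) (λ ()) (ℕ.m≤m+n n 0)

  indeg-pos : ∀ {e v} → head e ≡ v → 1 ≤ indeg v
  indeg-pos {e} {v} e↦v = ∈-length (∈-filter⁺ (λ x → head x ≟ v) (∈-allFin e) e↦v)

  outdeg-pos : ∀ {e v} → tail e ≡ v → 1 ≤ outdeg v
  outdeg-pos {e} {v} e↤v = ∈-length (∈-filter⁺ (λ x → tail x ≟ v) (∈-allFin e) e↤v)

  source-no-in : ∀ {s} → IsSource s → ∀ e → head e ≢ s
  source-no-in source e e↦s with subst (1 ≤_) source (indeg-pos e↦s)
  ... | ()

  sink-no-out : ∀ {t} → IsSink t → ∀ e → tail e ≢ t
  sink-no-out sink e e↤t with subst (1 ≤_) sink (outdeg-pos e↤t)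
  ... | ()

  no-in⇒source : ∀ {s} → (∀ e → head e ≢ s) → IsSource s
  no-in⇒source {s} no-in =
    cong length (filter-none (λ x → head x ≟ s) (All.tabulate {xs = allFin m} λ {e} _ → no-in e))

  no-out⇒sink : ∀ {t} → (∀ e → tail e ≢ t) → IsSink t
  no-out⇒sink {t} no-out =
    cong length (filter-none (λ x → tail x ≟ t) (All.tabulate {xs = allFin m} λ {e} _ → no-out e))

  inLt-total : ∀ v → ∃ (λ e → tail e ≡ v) → ∃ (λ e → head e ≡ v) →
               IsStrictTotalOn (λ e → head e ≡ v) (inLt v)
  inLt-total v (a , a↤v) (b , b↦v) = inTotal v (indeg-pos b↦v , outdeg-pos a↤v)

  outLt-total : ∀ v → ∃ (λ e → head e ≡ v) → ∃ (λ e → tail e ≡ v) →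
                IsStrictTotalOn (λ e → tail e ≡ v) (outLt v)
  outLt-total v (a , a↦v) (b , b↤v) = outTotal v (indeg-pos a↦v , outdeg-pos b↤v)

  walk⇒path : ∀ {u v e es} → Walk tail head u v (e ∷ es) → Path u v (e ∷ es)
  walk⇒path (step e refl done)             = one e
  walk⇒path (step e refl rest@(step _ _ _)) = cons e (walk⇒path rest)

  forward-acyclic : ∀ {v es} → Walk tail head v v es → es ≡ []
  forward-acyclic done           = refl
  forward-acyclic w@(step _ _ _) = ⊥-elim (acyclic _ _ (walk⇒path w))

  walk-reverse : ∀ {u v es} → Walk head tail u v es → Walk tail head v u (reverse es)
  walk-reverse done = done
  walk-reverse {es = e ∷ es} (step e refl w) =
    subst (Walk tail head _ _) (sym (unfold-reverse e es)) (walk-∷ʳ (walk-reverse w) refl)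

  backward-acyclic : ∀ {v es} → Walk head tail v v es → es ≡ []
  backward-acyclic w = reverse-injective (forward-acyclic (walk-reverse w))

  -- Lexicographic orders and crossings

  -- Compare two edge lists by their first differing edges a, b, in the order at k a:
  -- RevPrefixLt is Lex head inLt and SuffixLt is Lex tail outLt.
  Lex : (Edge → Vertex) → (Vertex → Edge → Edge → Set) → List Edge → List Edge → Set
  Lex k R []       _        = ⊥
  Lex k R (_ ∷ _)  []       = ⊥
  Lex k R (a ∷ as) (b ∷ bs) = (a ≡ b × Lex k R as bs) ⊎ (a ≢ b × R (k a) a b)

  RevPrefixLt⇒Lex : ∀ as bs → RevPrefixLt as bs → Lex head inLt as bs
  RevPrefixLt⇒Lex (a ∷ as) (b ∷ bs) (inj₁ (eq , lt)) = inj₁ (eq , RevPrefixLt⇒Lex as bs lt)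
  RevPrefixLt⇒Lex (a ∷ as) (b ∷ bs) (inj₂ lt)        = inj₂ lt

  Lex⇒RevPrefixLt : ∀ as bs → Lex head inLt as bs → RevPrefixLt as bs
  Lex⇒RevPrefixLt (a ∷ as) (b ∷ bs) (inj₁ (eq , lt)) = inj₁ (eq , Lex⇒RevPrefixLt as bs lt)
  Lex⇒RevPrefixLt (a ∷ as) (b ∷ bs) (inj₂ lt)        = inj₂ lt

  SuffixLt⇒Lex : ∀ as bs → SuffixLt as bs → Lex tail outLt as bs
  SuffixLt⇒Lex (a ∷ as) (b ∷ bs) (inj₁ (eq , lt)) = inj₁ (eq , SuffixLt⇒Lex as bs lt)
  SuffixLt⇒Lex (a ∷ as) (b ∷ bs) (inj₂ lt)        = inj₂ lt

  Lex⇒SuffixLt : ∀ as bs → Lex tail outLt as bs → SuffixLt as bs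
  Lex⇒SuffixLt (a ∷ as) (b ∷ bs) (inj₁ (eq , lt)) = inj₁ (eq , Lex⇒SuffixLt as bs lt)
  Lex⇒SuffixLt (a ∷ as) (b ∷ bs) (inj₂ lt)        = inj₂ lt

  module _ {k : Edge → Vertex} {R : Vertex → Edge → Edge → Set} where

    Lex-irrefl : ∀ as → ¬ Lex k R as as
    Lex-irrefl (a ∷ as) (inj₁ (_ , lt)) = Lex-irrefl as lt
    Lex-irrefl (a ∷ as) (inj₂ (a≢a , _)) = a≢a refl

    Lex-∷⁻ : ∀ {g as bs} → Lex k R (g ∷ as) (g ∷ bs) → Lex k R as bs
    Lex-∷⁻ (inj₁ (_ , lt))   = lt
    Lex-∷⁻ (inj₂ (g≢g , _)) = ⊥-elim (g≢g refl)

    Lex-head : ∀ {g h as bs} → g ≢ h → Lex k R (g ∷ as) (h ∷ bs) → R (k g) g h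
    Lex-head g≢h (inj₁ (g≡h , _)) = ⊥-elim (g≢h g≡h)
    Lex-head g≢h (inj₂ (_ , lt))  = lt

    Lex-intro : ∀ {v a b as bs} → IsStrictTotalOn (λ e → k e ≡ v) (R v) →
                k a ≡ v → R v a b → Lex k R (a ∷ as) (b ∷ bs)
    Lex-intro order a↤v a<b =
      inj₂ ((λ { refl → order-irrefl order a↤v a<b }) , subst (λ u → R u _ _) (sym a↤v) a<b)

  module LexOnMaxWalks (k k' : Edge → Vertex) (R : Vertex → Edge → Edge → Set)
    (R-total : ∀ v → ∃ (λ e → k' e ≡ v) → ∃ (λ e → k e ≡ v) →
               IsStrictTotalOn (λ e → k e ≡ v) (R v)) where

    private
      _<_ = Lex k R

      R-to : ∀ {v x y} → k x ≡ v → R (k x) x y → R v x y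
      R-to x↤v = subst (λ u → R u _ _) x↤v

    Lex-trans : ∀ {v as bs cs} → ∃ (λ e → k' e ≡ v) →
                MaxWalk k k' v as → MaxWalk k k' v bs → MaxWalk k k' v cs → as < bs → bs < cs → as < cs
    Lex-trans _ (step a _ wa) (step .a _ wb) (step .a _ wc) (inj₁ (refl , lt₁)) (inj₁ (refl , lt₂)) =
      inj₁ (refl , Lex-trans (a , refl) wa wb wc lt₁ lt₂)
    Lex-trans _ (step a _ _) (step .a _ _) (step c _ _) (inj₁ (refl , _)) (inj₂ lt) = inj₂ lt
    Lex-trans _ (step a _ _) (step b _ _) (step .b _ _) (inj₂ lt) (inj₁ (refl , _)) = inj₂ lt
    Lex-trans arrival (step a refl _) (step b b↤v _) (step c c↤v _) (inj₂ (_ , a<b)) (inj₂ (_ , b<c)) =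
      Lex-intro order refl (order-trans order refl b↤v c↤v a<b (R-to b↤v b<c))
      where order = R-total (k a) arrival (a , refl)

    Lex-trichotomous : ∀ {v as bs} → ∃ (λ e → k' e ≡ v) →
                       MaxWalk k k' v as → MaxWalk k k' v bs → as < bs ⊎ as ≡ bs ⊎ bs < as
    Lex-trichotomous _ (stuck _)    (stuck _)      = inj₂ (inj₁ refl)
    Lex-trichotomous _ (stuck none) (step b b↤v _) = ⊥-elim (none b b↤v)
    Lex-trichotomous _ (step a a↤v _) (stuck none) = ⊥-elim (none a a↤v)
    Lex-trichotomous {v} arrival (step a a↤v wa) (step b b↤v wb) with R-total v arrival (a , a↤v)
    ... | order with order-trich order a↤v b↤v
    ...   | inj₁ a<b        = inj₁ (Lex-intro order a↤v a<b)
    ...   | inj₂ (inj₂ b<a) = inj₂ (inj₂ (Lex-intro order b↤v b<a))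
    ...   | inj₂ (inj₁ refl) with Lex-trichotomous (a , refl) wa wb
    ...     | inj₁ lt          = inj₁ (inj₁ (refl , lt))
    ...     | inj₂ (inj₁ refl) = inj₂ (inj₁ refl)
    ...     | inj₂ (inj₂ lt)   = inj₂ (inj₂ (inj₁ (refl , lt)))

    Lex-dec : ∀ {v as bs} → ∃ (λ e → k' e ≡ v) →
              MaxWalk k k' v as → MaxWalk k k' v bs → Dec (as < bs)
    Lex-dec {as = as} arrival wa wb with Lex-trichotomous arrival wa wb
    ... | inj₁ lt          = yes lt
    ... | inj₂ (inj₁ refl) = no (Lex-irrefl as)
    ... | inj₂ (inj₂ gt)   = no λ lt → Lex-irrefl as (Lex-trans arrival wa wb wa lt gt)

  Lex-nonempty : ∀ {k R as bs} → Lex k R as bs → IsCons as × IsCons bs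
  Lex-nonempty {as = []} ()
  Lex-nonempty {as = _ ∷ _} {[]} ()
  Lex-nonempty {as = a ∷ as} {b ∷ bs} _ = (a , as , refl) , (b , bs , refl)

  -- P, P' are the parts before a common vertex of two routes, reversed (so read against
  -- the orientation src → tgt), and S, S' the parts after it.
  data Crossing (src tgt : Edge → Vertex) (InLt OutLt : Vertex → Edge → Edge → Set)
                (P S P' S' : List Edge) : Set where
    prefix-below : Lex tgt InLt P P' → Lex src OutLt S' S → Crossing src tgt InLt OutLt P S P' S'
    prefix-above : Lex tgt InLt P' P → Lex src OutLt S S' → Crossing src tgt InLt OutLt P S P' S'

  module _ {src tgt : Edge → Vertex} {InLt OutLt : Vertex → Edge → Edge → Set} where

    crossing-swap : ∀ {P S P' S'} → Crossing src tgt InLt OutLt P S P' S' →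
                    Crossing tgt src OutLt InLt S P S' P'
    crossing-swap (prefix-below p s) = prefix-above s p
    crossing-swap (prefix-above p s) = prefix-below s p

    crossing-irrefl : ∀ {P S} → ¬ Crossing src tgt InLt OutLt P S P S
    crossing-irrefl {P} (prefix-below p _) = Lex-irrefl P p
    crossing-irrefl {P} (prefix-above p _) = Lex-irrefl P p

    crossing-retreat : ∀ {g P S P' S'} → Crossing src tgt InLt OutLt (g ∷ P) S (g ∷ P') S' →
                       Crossing src tgt InLt OutLt P (g ∷ S) P' (g ∷ S')
    crossing-retreat (prefix-below p s) = prefix-below (Lex-∷⁻ p) (inj₁ (refl , s))
    crossing-retreat (prefix-above p s) = prefix-above (Lex-∷⁻ p) (inj₁ (refl , s))

    crossing-prefix-head : ∀ {g h P Q S P' S'} → g ≢ h →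
                           Crossing src tgt InLt OutLt (g ∷ P) S (h ∷ P') S' →
                           Crossing src tgt InLt OutLt (g ∷ Q) S (h ∷ P') S'
    crossing-prefix-head g≢h (prefix-below p s) = prefix-below (inj₂ (g≢h , Lex-head g≢h p)) s
    crossing-prefix-head g≢h (prefix-above p s) =
      prefix-above (inj₂ (g≢h ∘ sym , Lex-head (g≢h ∘ sym) p)) s

    crossing-nonempty : ∀ {P S P' S'} → Crossing src tgt InLt OutLt P S P' S' →
                        IsCons P × IsCons S × IsCons P' × IsCons S'
    crossing-nonempty (prefix-below p s) with Lex-nonempty p | Lex-nonempty s
    ... | P⁺ , P'⁺ | S'⁺ , S⁺ = P⁺ , S⁺ , P'⁺ , S'⁺
    crossing-nonempty (prefix-above p s) with Lex-nonempty p | Lex-nonempty s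
    ... | P'⁺ , P⁺ | S⁺ , S'⁺ = P⁺ , S⁺ , P'⁺ , S'⁺

  Crosses : (P S P' S' : List Edge) → Set
  Crosses = Crossing tail head inLt outLt

  -- Routes pointed at a vertex

  -- P ʳ++ S is a maximal walk through v: P is its part before v, reversed, and S the rest.
  Pointed : Vertex → List Edge → List Edge → Set
  Pointed v P S = MaxWalk head tail v P × MaxWalk tail head v S

  pointed-advance : ∀ {v P f S} → Pointed v P (f ∷ S) → Pointed (head f) (f ∷ P) S
  pointed-advance {P = P} (wP , step f f↤v wS) =
    step f refl (subst (λ u → MaxWalk head tail u P) (sym f↤v) wP) , wS

  pointed-retreat : ∀ {v g P S} → Pointed v (g ∷ P) S → Pointed (tail g) P (g ∷ S)
  pointed-retreat {S = S} (step g g↦v wP , wS) =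
    wP , step g refl (subst (λ u → MaxWalk tail head u S) (sym g↦v) wS)

  pointed-advance-many : ∀ c {v P S} → Pointed v P (c ++ S) → ∃ λ u → Pointed u (c ʳ++ P) S
  pointed-advance-many []      pw = _ , pw
  pointed-advance-many (f ∷ c) pw = pointed-advance-many c (pointed-advance pw)

  path⇒maxWalk : ∀ {u t es} → Path u t es → IsSink t → MaxWalk tail head u es
  path⇒maxWalk (one e)    sink = step e refl (stuck (sink-no-out sink))
  path⇒maxWalk (cons e p) sink = step e refl (path⇒maxWalk p sink)

  maxWalk⇒path : ∀ {u f S} → MaxWalk tail head u (f ∷ S) → ∃ λ t → IsSink t × Path u t (f ∷ S)
  maxWalk⇒path (step f refl (stuck none)) = head f , no-out⇒sink none , one f
  maxWalk⇒path (step f refl w@(step _ _ _)) with maxWalk⇒path w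
  ... | t , sink , p = t , sink , cons f p

  pointed⇒route : ∀ {v P f S} → Pointed v P (f ∷ S) → IsRoute (P ʳ++ (f ∷ S))
  pointed⇒route {v} {[]} (stuck none , wS) with maxWalk⇒path wS
  ... | t , sink , p = v , t , no-in⇒source none , sink , p
  pointed⇒route {P = g ∷ P} pw = pointed⇒route (pointed-retreat pw)

  AnchoredAt : Vertex → List Edge → List Edge → Set
  AnchoredAt v []      []      = ⊥
  AnchoredAt v []      (f ∷ _) = tail f ≡ v
  AnchoredAt v (g ∷ _) _       = head g ≡ v

  anchoredAt? : ∀ v P S → Dec (AnchoredAt v P S)
  anchoredAt? v []      []      = no λ ()
  anchoredAt? v []      (f ∷ _) = tail f ≟ v
  anchoredAt? v (g ∷ _) _       = head g ≟ v

  pointed⇒anchored : ∀ {v P S} → IsRoute (P ʳ++ S) → Pointed v P S → AnchoredAt v P S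
  pointed⇒anchored {P = []} {[]} (_ , _ , _ , _ , ()) _
  pointed⇒anchored {P = []} {f ∷ _} _ (_ , step _ f↤v _) = f↤v
  pointed⇒anchored {P = g ∷ _} _ (step _ g↦v _ , _) = g↦v

  anchored-repoint : ∀ {u v P S} → AnchoredAt v P S → Pointed u P S → Pointed v P S
  anchored-repoint {P = []} {f ∷ _} f↤v pw@(_ , step _ f↤u _) =
    subst (λ x → Pointed x _ _) (trans (sym f↤u) f↤v) pw
  anchored-repoint {P = g ∷ _} g↦v pw@(step _ g↦u _ , _) =
    subst (λ x → Pointed x _ _) (trans (sym g↦u) g↦v) pw

  route-pointed : ∀ {v P S} → IsRoute (P ʳ++ S) → AnchoredAt v P S → Pointed v P S
  route-pointed {P = P} {S} (s , t , source , sink , path) anchored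
    with pointed-advance-many (reverse P)
           (subst (Pointed s []) (ʳ++-defn P) (stuck (source-no-in source) , path⇒maxWalk path sink))
  ... | u , pw =
    anchored-repoint anchored (subst (λ X → Pointed u X S) (trans (reverse-ʳ++ P) (++-identityʳ P)) pw)

  PrefixLt⇒Lex : ∀ q q' {e e'} → PrefixLt (q ++ [ e ]) (q' ++ [ e' ]) →
                 Lex head inLt (e ∷ reverse q) (e' ∷ reverse q')
  PrefixLt⇒Lex q q' {e} {e'} lt =
    RevPrefixLt⇒Lex _ _ (subst₂ RevPrefixLt (reverse-++ q [ e ]) (reverse-++ q' [ e' ]) lt)

  Lex⇒PrefixLt : ∀ Q Q' {e e'} → Lex head inLt (e ∷ Q) (e' ∷ Q') →
                 PrefixLt (reverse Q ++ [ e ]) (reverse Q' ++ [ e' ])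
  Lex⇒PrefixLt Q Q' {e} {e'} lt =
    subst₂ RevPrefixLt (sym (reverse-reverse-∷ʳ Q e)) (sym (reverse-reverse-∷ʳ Q' e'))
           (Lex⇒RevPrefixLt _ _ lt)
    where
      reverse-reverse-∷ʳ : ∀ (Q : List Edge) e → reverse (reverse Q ++ [ e ]) ≡ e ∷ Q
      reverse-reverse-∷ʳ Q e = trans (reverse-++ (reverse Q) [ e ]) (cong (e ∷_) (reverse-involutive Q))

  crossing⇒incompatible : ∀ {v P S P' S'} → Pointed v P S → Pointed v P' S' → Crosses P S P' S' →
                          IncompatibleAt v (P ʳ++ S) (P' ʳ++ S')
  crossing⇒incompatible pw pw' cr with crossing-nonempty cr
  crossing⇒incompatible (step _ e↦v _ , _) (step _ e'↦v _ , _) cr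
    | (e , Q , refl) , (f , t , refl) , (e' , Q' , refl) , (f' , t' , refl) =
    reverse Q , e , f , t , reverse Q' , e' , f' , t' ,
    ʳ++-defn Q , e↦v , ʳ++-defn Q' , e'↦v , convert cr
    where
      convert : Crosses (e ∷ Q) (f ∷ t) (e' ∷ Q') (f' ∷ t') → _
      convert (prefix-below p s) = inj₁ (Lex⇒PrefixLt Q Q' p , Lex⇒SuffixLt _ _ s)
      convert (prefix-above p s) = inj₂ (Lex⇒PrefixLt Q' Q p , Lex⇒SuffixLt _ _ s)

  incompatible⇒crossing : ∀ {v τ τ'} → IsRoute τ → IsRoute τ' → IncompatibleAt v τ τ' →
    ∃₂ λ P S → ∃₂ λ P' S' →
      τ ≡ P ʳ++ S × Pointed v P S × τ' ≡ P' ʳ++ S' × Pointed v P' S' × Crosses P S P' S'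
  incompatible⇒crossing route route' (q , e , f , t , q' , e' , f' , t' , τ≡ , e↦v , τ'≡ , e'↦v , cr) =
    e ∷ reverse q , f ∷ t , e' ∷ reverse q' , f' ∷ t' ,
    split τ≡ , route-pointed (subst IsRoute (split τ≡) route) e↦v ,
    split τ'≡ , route-pointed (subst IsRoute (split τ'≡) route') e'↦v ,
    convert cr
    where
      split : ∀ {τ q e f t} → τ ≡ q ++ e ∷ f ∷ t → τ ≡ (e ∷ reverse q) ʳ++ (f ∷ t)
      split {q = q} τ≡ = trans τ≡ (sym (reverse-ʳ++ q))
      convert : _ → Crosses (e ∷ reverse q) (f ∷ t) (e' ∷ reverse q') (f' ∷ t')
      convert (inj₁ (p , s)) = prefix-below (PrefixLt⇒Lex q q' p) (SuffixLt⇒Lex _ _ s)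
      convert (inj₂ (p , s)) = prefix-above (PrefixLt⇒Lex q' q p) (SuffixLt⇒Lex _ _ s)

  incompatible-sym : ∀ {v τ τ'} → IncompatibleAt v τ τ' → IncompatibleAt v τ' τ
  incompatible-sym (q , e , f , t , q' , e' , f' , t' , τ≡ , e↦v , τ'≡ , e'↦v , cr) =
    q' , e' , f' , t' , q , e , f , t , τ'≡ , e'↦v , τ≡ , e↦v , ⊎-swap cr

  ¬crossing⇒compatible : ∀ {τ τ'} → IsRoute τ → IsRoute τ' →
    (∀ {v P S P' S'} → τ ≡ P ʳ++ S → Pointed v P S → τ' ≡ P' ʳ++ S' → Pointed v P' S' →
                       ¬ Crosses P S P' S') →
    Compatible τ τ'
  ¬crossing⇒compatible route route' no-crossing v incompatible
    with incompatible⇒crossing route route' incompatible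
  ... | _ , _ , _ , _ , τ≡ , pw , τ'≡ , pw' , cr = no-crossing τ≡ pw τ'≡ pw' cr

  -- Read forwards c leaves v, read backwards it enters v, so it would be a cycle.
  no-detour : ∀ c {v P S} → MaxWalk head tail v (c ʳ++ P) → MaxWalk tail head v (c ++ S) → c ≡ []
  no-detour []      _  _ = refl
  no-detour (x ∷ c) wP (step .x x↤v _)
    with maxWalk-split (reverse (x ∷ c)) (subst (MaxWalk head tail _) (ʳ++-defn (x ∷ c)) wP)
  ... | u , back , _ with subst (Walk tail head u _) (reverse-involutive (x ∷ c)) (walk-reverse back)
  ...   | cycle@(step .x x↤u _)
    with forward-acyclic (subst (λ y → Walk tail head y _ _) (trans (sym x↤u) x↤v) cycle)
  ...     | ()

  pointings-coincide : ∀ {v P S P' S'} → Pointed v P S → Pointed v P' S' → P ʳ++ S ≡ P' ʳ++ S' →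
                       P ≡ P' × S ≡ S'
  pointings-coincide {P = P} {P' = P'} (wP , wS) (wP' , wS') eq with ʳ++-split P P' eq
  ... | inj₁ (c , refl , refl) with no-detour c wP wS'
  ...   | refl = refl , refl
  pointings-coincide (wP , wS) (wP' , wS') eq | inj₂ (c , refl , refl) with no-detour c wP' wS
  ...   | refl = refl , refl

  route-self-compatible : ∀ {τ} → IsRoute τ → Compatible τ τ
  route-self-compatible route = ¬crossing⇒compatible route route λ τ≡ pw τ≡′ pw' cr →
    case pointings-coincide pw pw' (trans (sym τ≡) τ≡′) of λ where
      (refl , refl) → crossing-irrefl cr

  -- Continuing an unused edge

  -- The construction in an arbitrary orientation src → tgt: with src = tail it continues e
  -- forwards, with src = head and the two orders swapped it continues e backwards.
  module Extension (src tgt : Edge → Vertex) (InLt OutLt : Vertex → Edge → Edge → Set)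
    (InLt-total : ∀ v → ∃ (λ e → src e ≡ v) → ∃ (λ e → tgt e ≡ v) →
                  IsStrictTotalOn (λ e → tgt e ≡ v) (InLt v))
    (OutLt-total : ∀ v → ∃ (λ e → tgt e ≡ v) → ∃ (λ e → src e ≡ v) →
                   IsStrictTotalOn (λ e → src e ≡ v) (OutLt v))
    (successor-wellFounded : WellFounded (Successor {src} {tgt}))
    where

    open LexOnMaxWalks src tgt OutLt OutLt-total

    Cross : (P S P' S' : List Edge) → Set
    Cross = Crossing src tgt InLt OutLt

    -- The routes of a clique, pointed at each of their vertices, seen in this orientation.
    record PointedFamily : Set₁ where
      field
        Member       : Vertex → List Edge → List Edge → Set
        prefix-walk  : ∀ {v P S} → Member v P S → MaxWalk tgt src v P
        suffix-walk  : ∀ {v P S} → Member v P S → MaxWalk src tgt v S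
        advance      : ∀ {v P f S} → Member v P (f ∷ S) → Member (tgt f) (f ∷ P) S
        retreat      : ∀ {v g P S} → Member v (g ∷ P) S → Member (src g) P (g ∷ S)
        non-crossing : ∀ {v P S P' S'} → Member v P S → Member v P' S' → ¬ Cross P S P' S'
        members      : ∀ v → Enumeration (Member v)

    module Continuation (F : PointedFamily) where
      open PointedFamily F

      Unused : Edge → Set
      Unused g = ∀ {v A S} → ¬ Member v (g ∷ A) S

      -- Whatever A precedes g₀, the walk g₀ ∷ γ crosses no member at a vertex reached after g₀.
      SafeAfter : Edge → List Edge → Set
      SafeAfter g₀ γ = ∀ A c S {v P' S'} → γ ≡ c ++ S → MaxWalk tgt src v (c ʳ++ (g₀ ∷ A)) →
                       Member v P' S' → ¬ Cross (c ʳ++ (g₀ ∷ A)) S P' S'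

      member-at : ∀ {u v P S} → u ≡ v → Member u P S → Member v P S
      member-at u≡v = subst (λ x → Member x _ _) u≡v

      advance-along : ∀ g Pc S {x P} → Member x P ((g ∷ Pc) ʳ++ S) → Member (tgt g) (g ∷ Pc ++ P) S
      advance-along g []        S m = advance m
      advance-along g (g′ ∷ Pc) S m = advance (advance-along g′ Pc (g ∷ S) m)

      unused-leaving-empty : ∀ {w f} → src f ≡ w → (∀ {P S} → ¬ Member w P S) → Unused f
      unused-leaving-empty f↤w empty m = empty (member-at f↤w (retreat m))

      safe-[] : ∀ {g₀} → SafeAfter g₀ []
      safe-[] A [] .[] refl _ _ cr with crossing-nonempty cr
      ... | _ , (_ , _ , ()) , _

      safe-∷ : ∀ {w g₀ f γ} → tgt g₀ ≡ w → (∀ {P S} → ¬ Member w P S) →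
               SafeAfter f γ → SafeAfter g₀ (f ∷ γ)
      safe-∷ g₀↦w empty safe A [] S refl (step _ g₀↦v _) m =
        ⊥-elim (empty (member-at (trans (sym g₀↦v) g₀↦w) m))
      safe-∷ {g₀ = g₀} g₀↦w empty safe A (f ∷ c) S eq walk m with ∷-injective eq
      ... | refl , γ≡ = safe (g₀ ∷ A) c S γ≡ walk m

      module Branch {w g₀ f} (g₀↦w : tgt g₀ ≡ w) (f↤w : src f ≡ w) (g₀-unused : Unused g₀) where

        private
          order = InLt-total w (f , f↤w) (g₀ , g₀↦w)

          enters : ∀ {h A S} → Member w (h ∷ A) S → tgt h ≡ w
          enters m with prefix-walk m
          ... | step _ h↦w _ = h↦w

        Balanced : List Edge → Set
        Balanced γ = ∀ {h A S} → Member w (h ∷ A) S →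
                     (InLt w h g₀ → ¬ Lex src OutLt γ S) × (InLt w g₀ h → ¬ Lex src OutLt S γ)

        balanced-branch : ∀ {γ} → Balanced γ →
                          ∀ A {P' S'} → Member w P' S' → ¬ Cross (g₀ ∷ A) γ P' S'
        balanced-branch bal A {[]} m cr with crossing-nonempty cr
        ... | _ , _ , (_ , _ , ()) , _
        balanced-branch bal A {h ∷ A'} m (prefix-below p s) =
          proj₂ (bal m) (subst (λ u → InLt u g₀ h) g₀↦w (Lex-head (λ { refl → g₀-unused m }) p)) s
        balanced-branch bal A {h ∷ A'} m (prefix-above p s) =
          proj₁ (bal m) (subst (λ u → InLt u h g₀) (enters m) (Lex-head (λ { refl → g₀-unused m }) p)) s

        balanced-safe : ∀ {Pσ γ} → Member w Pσ γ → Balanced γ → SafeAfter g₀ γ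
        balanced-safe {Pσ} {γ} σ bal A c S {v} {P'} {S'} γ≡ walk m cr =
          along (reverse c) S (trans γ≡ (sym (reverse-ʳ++ c))) (subst (MaxWalk tgt src v) (ʳ++-defn c) walk) m
                (subst (λ X → Cross X S P' S') (ʳ++-defn c) cr)
          where
            -- Going back from v: while the member follows our walk we retreat along it; where it
            -- first leaves it after g₀, σ, which shares that part of our walk, crosses it as well.
            along : ∀ Pc S {v P' S'} → γ ≡ Pc ʳ++ S → MaxWalk tgt src v (Pc ++ g₀ ∷ A) →
                    Member v P' S' → ¬ Cross (Pc ++ g₀ ∷ A) S P' S'
            along [] S refl (step _ g₀↦v _) m =
              balanced-branch bal A (member-at (trans (sym g₀↦v) g₀↦w) m)
            along (g ∷ Pc) S {P' = []} γ≡ walk m cr with crossing-nonempty cr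
            ... | _ , _ , (_ , _ , ()) , _
            along (g ∷ Pc) S {P' = h ∷ A'} γ≡ (step _ g↦v walk) m cr with g ≟ h
            ... | yes refl = along Pc (g ∷ S) γ≡ walk (retreat m) (crossing-retreat cr)
            ... | no g≢h   =
              non-crossing (member-at g↦v (advance-along g Pc S (subst (Member w Pσ) γ≡ σ))) m
                           (crossing-prefix-head g≢h cr)

        private
          Ok : List Edge × List Edge → Set
          Ok = uncurry (Member w)

          Below : List Edge × List Edge → Set
          Below ([]    , _) = ⊥
          Below (h ∷ _ , _) = InLt w h g₀

          below? : ∀ {z} → Ok z → Dec (Below z)
          below? {[]    , _} _ = no λ ()
          below? {h ∷ _ , _} m with order-trich order (enters m) g₀↦w
          ... | inj₁ h<g₀        = yes h<g₀
          ... | inj₂ (inj₁ refl) = ⊥-elim (g₀-unused m)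
          ... | inj₂ (inj₂ g₀<h) =
            no λ h<g₀ →
              order-irrefl order g₀↦w (order-trans order g₀↦w (enters m) g₀↦w g₀<h h<g₀)

          _<ˢ_ : List Edge × List Edge → List Edge × List Edge → Set
          (_ , S) <ˢ (_ , S') = Lex src OutLt S S'

          <ˢ-irrefl : ∀ {z} → ¬ z <ˢ z
          <ˢ-irrefl {_ , S} = Lex-irrefl S

          <ˢ-trans : ∀ {x y z} → Ok x → Ok y → Ok z → x <ˢ y → y <ˢ z → x <ˢ z
          <ˢ-trans mx my mz = Lex-trans (g₀ , g₀↦w) (suffix-walk mx) (suffix-walk my) (suffix-walk mz)

          <ˢ-dec : ∀ {x y} → Ok x → Ok y → Dec (x <ˢ y)
          <ˢ-dec mx my = Lex-dec (g₀ , g₀↦w) (suffix-walk mx) (suffix-walk my)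

        -- The largest suffix of a member entering w below g₀, or else the smallest suffix.
        balanced-choice : ∀ {z zs} → (∀ {P S} → (P , S) ∈ z ∷ zs → Member w P S) →
                          (∀ {P S} → Member w P S → (P , S) ∈ z ∷ zs) →
                          ∃₂ λ Pσ γ → Member w Pσ γ × Balanced γ
        balanced-choice {z} {zs} sound complete
          with maximal-satisfying Ok Below _<ˢ_ below? (λ {z} → <ˢ-irrefl {z}) <ˢ-trans <ˢ-dec
                 (z ∷ zs) (All.tabulate λ {(_ , _)} → sound)
        ... | inj₂ ((hσ ∷ Aσ , γ) , σ∈ , hσ<g₀ , σ-max) =
          hσ ∷ Aσ , γ , sound σ∈ , λ m → σ-max (complete m) , λ g₀<h S<γ →
            non-crossing (sound σ∈) m
              (prefix-below (Lex-intro order (enters (sound σ∈))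
                              (order-trans order (enters (sound σ∈)) g₀↦w (enters m) hσ<g₀ g₀<h)) S<γ)
        ... | inj₁ none-below
          with maximal-satisfying Ok (λ _ → ⊤) (flip _<ˢ_) (λ _ → yes tt) (λ {z} → <ˢ-irrefl {z})
                 (λ mx my mz x>y y>z → <ˢ-trans mz my mx y>z x>y) (λ mx my → <ˢ-dec my mx)
                 (z ∷ zs) (All.tabulate λ {(_ , _)} → sound)
        ...   | inj₂ ((Pσ , γ) , σ∈ , _ , σ-min) =
          Pσ , γ , sound σ∈ , λ m →
            (λ h<g₀ → ⊥-elim (All.lookup none-below (complete m) h<g₀)) , (λ _ → σ-min (complete m) tt)
        ...   | inj₁ none = ⊥-elim (All.lookup none (here refl) tt)

      safe-continuation : ∀ {w} → Acc Successor w → ∀ g₀ → tgt g₀ ≡ w → Unused g₀ →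
                          ∃ λ γ → MaxWalk src tgt w γ × SafeAfter g₀ γ
      safe-continuation {w} (acc smaller) g₀ g₀↦w g₀-unused with any? (λ f → src f ≟ w)
      ... | no dead-end = [] , stuck (λ f f↤w → dead-end (f , f↤w)) , safe-[]
      ... | yes (f , f↤w) with members w
      ...   | [] , _ , complete
        with safe-continuation (smaller (f , f↤w , refl)) f refl
               (unused-leaving-empty f↤w (λ m → case complete m of λ ()))
      ...     | γ , walk , safe =
        f ∷ γ , step f f↤w walk , safe-∷ g₀↦w (λ m → case complete m of λ ()) safe
      safe-continuation {w} _ g₀ g₀↦w g₀-unused | yes (f , f↤w) | z ∷ zs , sound , complete
        with Branch.balanced-choice g₀↦w f↤w g₀-unused sound complete
      ...     | _ , γ , σ , balanced =
        γ , suffix-walk σ , Branch.balanced-safe g₀↦w f↤w g₀-unused σ balanced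

      continue : ∀ g₀ → Unused g₀ → ∃ λ γ → MaxWalk src tgt (tgt g₀) γ × SafeAfter g₀ γ
      continue g₀ = safe-continuation (successor-wellFounded (tgt g₀)) g₀ refl

  module Forward  = Extension tail head inLt outLt inLt-total outLt-total (successor-wellFounded forward-acyclic)
  module Backward = Extension head tail outLt inLt outLt-total inLt-total (successor-wellFounded backward-acyclic)

  clique-∷ : ∀ {K ρ} → IsClique K → IsRoute ρ → (∀ {τ} → τ ∈ K → Compatible ρ τ) →
             IsClique (ρ ∷ K)
  clique-∷ {K} {ρ} (routes , compatible) ρ-route ρ-compatible = routes′ , compatible′
    where
      routes′ : ∀ τ → τ ∈ ρ ∷ K → IsRoute τ
      routes′ _ (here refl) = ρ-route
      routes′ τ (there τ∈K) = routes τ τ∈K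
      compatible′ : ∀ τ τ′ → τ ∈ ρ ∷ K → τ′ ∈ ρ ∷ K → Compatible τ τ′
      compatible′ _ _ (here refl) (here refl) = route-self-compatible ρ-route
      compatible′ _ _ (here refl) (there τ′∈K) = ρ-compatible τ′∈K
      compatible′ _ _ (there τ∈K) (here refl) = λ v → ρ-compatible τ∈K v ∘ incompatible-sym
      compatible′ τ τ′ (there τ∈K) (there τ′∈K) = compatible τ τ′ τ∈K τ′∈K

  module RouteThrough (K : List (List Edge)) (clique : IsClique K) (e : Edge)
                    (unused : ∀ {τ} → τ ∈ K → e ∉ τ) where

    private
      routes = proj₁ clique
      compatible = proj₂ clique

    Member : Vertex → List Edge → List Edge → Set
    Member v P S = P ʳ++ S ∈ K × Pointed v P S

    members : ∀ v → Enumeration (Member v)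
    members v = filter anchored? (concatMap (splitsʳ []) K) , sound , complete
      where
        anchored? : ∀ z → Dec (AnchoredAt v (proj₁ z) (proj₂ z))
        anchored? (P , S) = anchoredAt? v P S

        sound : ∀ {P S} → (P , S) ∈ filter anchored? (concatMap (splitsʳ []) K) → Member v P S
        sound {P} {S} z∈ with ∈-filter⁻ anchored? z∈
        ... | z∈splits , anchored with find (∈-concatMap⁻ (splitsʳ []) {xs = K} z∈splits)
        ...   | τ , τ∈K , z∈τ with subst (_∈ K) (sym (splitsʳ-sound [] τ z∈τ)) τ∈K
        ...     | PS∈K = PS∈K , route-pointed (routes _ PS∈K) anchored

        complete : ∀ {P S} → Member v P S → (P , S) ∈ filter anchored? (concatMap (splitsʳ []) K)
        complete {P} {S} (PS∈K , pw) =
          ∈-filter⁺ anchored? (∈-concatMap⁺ (splitsʳ []) (lose PS∈K (splitsʳ-complete P S)))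
                    (pointed⇒anchored (routes _ PS∈K) pw)

    forward-family : Forward.PointedFamily
    forward-family = record
      { Member       = Member
      ; prefix-walk  = λ (_ , wP , _) → wP
      ; suffix-walk  = λ (_ , _ , wS) → wS
      ; advance      = λ (PS∈K , pw) → PS∈K , pointed-advance pw
      ; retreat      = λ (PS∈K , pw) → PS∈K , pointed-retreat pw
      ; non-crossing = λ (PS∈K , pw) (PS∈K′ , pw′) cr →
                         compatible _ _ PS∈K PS∈K′ _ (crossing⇒incompatible pw pw′ cr)
      ; members      = members
      }

    backward-family : Backward.PointedFamily
    backward-family = record
      { Member       = λ v S P → Member v P S
      ; prefix-walk  = λ (_ , _ , wS) → wS
      ; suffix-walk  = λ (_ , wP , _) → wP
      ; advance      = λ (PS∈K , pw) → PS∈K , pointed-retreat pw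
      ; retreat      = λ (PS∈K , pw) → PS∈K , pointed-advance pw
      ; non-crossing = λ m m′ cr → Forward.PointedFamily.non-crossing forward-family m m′ (crossing-swap cr)
      ; members      = λ v → enumeration-flip (members v)
      }

    private
      module F = Forward.Continuation forward-family
      module B = Backward.Continuation backward-family

    joined-non-crossing : ∀ {α γ} → B.SafeAfter e α → F.SafeAfter e γ →
      ∀ {v P S P' S'} → P ʳ++ S ≡ α ʳ++ (e ∷ γ) → Pointed v P S → Member v P' S' →
      ¬ Crosses P S P' S'
    joined-non-crossing {α} {γ} α-safe γ-safe {P = P} eq (wP , wS) m cr with ʳ++-split P α eq
    ... | inj₁ ([] , refl , refl) = α-safe γ [] α refl wS m (crossing-swap cr)
    ... | inj₂ (c , refl , refl) =
      α-safe γ (reverse c) P (ʳ++-defn c) (subst (MaxWalk tail head _) (sym (reverse-ʳ++ c)) wS) m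
             (subst (λ X → Backward.Cross X _ _ _) (sym (reverse-ʳ++ c)) (crossing-swap cr))
    ... | inj₁ (_ ∷ c , refl , eq′) with ∷-injective eq′
    ...   | refl , γ≡ = γ-safe α c _ γ≡ wP m cr

    forward-part : ∃ λ γ → MaxWalk tail head (head e) γ × F.SafeAfter e γ
    forward-part = F.continue e λ {_} {A} (PS∈K , _) → unused PS∈K (∈-ʳ++-∷ A)

    backward-part : ∃ λ α → MaxWalk head tail (tail e) α × B.SafeAfter e α
    backward-part = B.continue e λ {_} {_} {S} (PS∈K , _) → unused PS∈K (∈-ʳ++-∷ S)

    ρ : List Edge
    ρ = proj₁ backward-part ʳ++ (e ∷ proj₁ forward-part)

    ρ-route : IsRoute ρ
    ρ-route = pointed⇒route (proj₁ (proj₂ backward-part) , step e refl (proj₁ (proj₂ forward-part)))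

    e∈ρ : e ∈ ρ
    e∈ρ = ∈-ʳ++-∷ (proj₁ backward-part)

    ρ-compatible : ∀ {τ} → τ ∈ K → Compatible ρ τ
    ρ-compatible τ∈K = ¬crossing⇒compatible ρ-route (routes _ τ∈K) λ ρ≡ pw τ≡ pw′ →
      joined-non-crossing (proj₂ (proj₂ backward-part)) (proj₂ (proj₂ forward-part)) (sym ρ≡) pw
                          (subst (_∈ K) τ≡ τ∈K , pw′)

proposition2p10 : (G : FramedDAG) (K : List (List (FramedDAG.Edge G))) →
    FramedDAG.IsMaximalClique G K →
    (e : FramedDAG.Edge G) → Σ (List (FramedDAG.Edge G)) (λ ρ → ρ ∈ K × e ∈ ρ)
proposition2p10 G K (clique , maximal) e with Any.any? (DecMembership._∈?_ _≟_ e) K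
... | yes used = find used
... | no unused =
  ρ , maximal (ρ ∷ K) (clique-∷ clique ρ-route ρ-compatible) (λ _ → there) ρ (here refl) , e∈ρ
  where open FramedDAGTheory G
        open RouteThrough K clique e (λ τ∈K e∈τ → unused (lose τ∈K e∈τ))
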